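{- Suppose $a=a(n)\gg1$ and $m=m(n)\gg n$ satisfy $a\le n^3/m^2$. Then, with probability tending to $1$ as $n\to\infty$, in $G_m$ every vertex set of size $q\le a$ spans at most $3q$ edges.
   Context: $G_m$ denotes the uniform random graph on vertex set $[n]$ with exactly $m$ edges (equivalently, the graph of the first $m$ edges in a uniformly random ordering of the edges of $K_n$). $f\ll g$ (equivalently $g\gg f$) means $f/g\to0$ as $n\to\infty$. -}

module Defs where

open import Data.Nat using (ℕ; zero; suc; _+_; _*_; _≤ᵇ_; _≡ᵇ_; _<ᵇ_)
open import Data.Bool using (Bool; true; false; _∧_; not; if_then_else_)
open import Data.Fin using (Fin; toℕ)
open import Data.List using (List; []; _∷_; map; concatMap; length; allFin; zip; foldr)
open import Data.Vec using (Vec; toList; lookup)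
import Data.Vec as V
open import Data.Product using (_×_; _,_)

boolFilter : {A : Set} → (A → Bool) → List A → List A
boolFilter p [] = []
boolFilter p (x ∷ xs) = if p x then x ∷ boolFilter p xs else boolFilter p xs

allVecs : (k : ℕ) → List (Vec Bool k)
allVecs zero = V.[] ∷ []
allVecs (suc k) = concatMap (λ v → (true V.∷ v) ∷ (false V.∷ v) ∷ []) (allVecs k)

card : {k : ℕ} → Vec Bool k → ℕ
card V.[] = 0
card (true V.∷ v) = suc (card v)
card (false V.∷ v) = card v

edgeList : (n : ℕ) → List (Fin n × Fin n)
edgeList n = concatMap (λ i → boolFilter (λ p → toℕ (Data.Product.proj₁ p) <ᵇ toℕ (Data.Product.proj₂ p))
                                         (map (λ j → (i , j)) (allFin n)))
                       (allFin n)

numEdges : ℕ → ℕ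
numEdges n = length (edgeList n)

-- A graph on [n] is a subset of the edges of K_n (indicator vector indexed by edgeList n).
Graph : ℕ → Set
Graph n = Vec Bool (numEdges n)

spanned : (n : ℕ) → Vec Bool n → Graph n → ℕ
spanned n S G =
  length (boolFilter (λ eb → Data.Product.proj₂ eb ∧ lookup S (Data.Product.proj₁ (Data.Product.proj₁ eb))
                                                   ∧ lookup S (Data.Product.proj₂ (Data.Product.proj₁ eb)))
                     (zip (edgeList n) (toList G)))

goodGraph : (a n : ℕ) → Graph n → Bool
goodGraph a n G =
  foldr _∧_ true (map (λ S → if card S ≤ᵇ a then spanned n S G ≤ᵇ 3 * card S else true) (allVecs n))

-- Number of graphs on [n] with exactly m edges (the sample space of G_m).
totalCount : (m n : ℕ) → ℕ
totalCount m n = length (boolFilter (λ G → card G ≡ᵇ m) (allVecs (numEdges n)))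

badCount : (a m n : ℕ) → ℕ
badCount a m n = length (boolFilter (λ G → (card G ≡ᵇ m) ∧ not (goodGraph a n G)) (allVecs (numEdges n)))

-- A graph is bad when some q-set S with q ≤ a spans at least t = 3q + 1 edges. A union bound over S and over t-sets of
-- pairs inside S counts at most Σ_q C(n,q) C(q²,t) C(N−t,m−t) bad m-edge graphs, where N = C(n,2). With
-- C(x,y) ≤ (8x/y)^y, C(N−t,m−t) ≤ C(N,m) (m/(N−t))^t and N − t ≥ n²/4, the q-th term is at most
-- C(N,m) 2^-(q+1)/(k+1) once m ≥ 2^19 (k+1) n: then a m² ≤ n³ gives q m ≤ n²/(2^19 (k+1)) and
-- n q² m³ ≤ n⁶/(2^19 (k+1)). Summing over q, at most a 1/(k+1) fraction of the m-edge graphs is bad.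

module Submission where

open import Defs
open import Data.Nat using (ℕ; suc; _*_; _^_; _≤_)
open import Data.Product using (∃-syntax)
open import Data.Bool using (Bool; true; false; T; _∧_; not; if_then_else_)
open import Data.Fin using (Fin; toℕ)
import Data.Fin as Fin
open import Data.List using (List; []; _∷_; _++_; map; concatMap; length; allFin; tabulate; zip; foldr)
open import Data.List.Properties using (length-++)
open import Data.Nat
open import Data.Nat.Combinatorics using (_C_; nC1≡n; nCk+nC[k+1]≡[n+1]C[k+1]; k>n⇒nCk≡0)
open import Data.Nat.Properties
open import Data.Nat.Tactic.RingSolver using (solve-∀)
open import Data.Product using (∃-syntax; _×_; _,_; proj₁; proj₂)
open import Data.Sum using (_⊎_; inj₁; inj₂; [_,_]′)
open import Data.Vec using (Vec; lookup; toList)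
import Data.Vec as Vec
open import Function using (_∘_)
open import Relation.Binary.PropositionalEquality
import Algebra.Properties.CommutativeSemigroup as CommSemigroupProperties
open CommSemigroupProperties +-commutativeSemigroup using ()
  renaming (interchange to +-interchange; x∙yz≈y∙xz to x+[y+z]≡y+[x+z])
open CommSemigroupProperties *-commutativeSemigroup using (x∙yz≈y∙xz; xy∙z≈y∙xz; xy∙z≈x∙zy; xy∙z≈xz∙y)

ind : Bool → ℕ
ind true = 1
ind false = 0

∑ : {A : Set} → List A → (A → ℕ) → ℕ
∑ [] f = 0
∑ (x ∷ xs) f = f x + ∑ xs f

syntax ∑ xs (λ x → e) = ∑[ x ∈ xs ] e

module _ {A : Set} where

  ∑-cong : (xs : List A) {f g : A → ℕ} → (∀ x → f x ≡ g x) → ∑ xs f ≡ ∑ xs g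
  ∑-cong [] f≡g = refl
  ∑-cong (x ∷ xs) f≡g = cong₂ _+_ (f≡g x) (∑-cong xs f≡g)

  ∑-mono-≤ : (xs : List A) {f g : A → ℕ} → (∀ x → f x ≤ g x) → ∑ xs f ≤ ∑ xs g
  ∑-mono-≤ [] f≤g = z≤n
  ∑-mono-≤ (x ∷ xs) f≤g = +-mono-≤ (f≤g x) (∑-mono-≤ xs f≤g)

  ∑-distrib-+ : (xs : List A) (f g : A → ℕ) → ∑[ x ∈ xs ] (f x + g x) ≡ ∑ xs f + ∑ xs g
  ∑-distrib-+ [] f g = refl
  ∑-distrib-+ (x ∷ xs) f g rewrite ∑-distrib-+ xs f g = +-interchange (f x) (g x) _ _

  ∑-distribˡ-* : (xs : List A) (c : ℕ) (f : A → ℕ) → ∑[ x ∈ xs ] (c * f x) ≡ c * ∑ xs f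
  ∑-distribˡ-* [] c f = sym (*-zeroʳ c)
  ∑-distribˡ-* (x ∷ xs) c f rewrite ∑-distribˡ-* xs c f = sym (*-distribˡ-+ c (f x) _)

  ∑-++ : (xs ys : List A) (f : A → ℕ) → ∑ (xs ++ ys) f ≡ ∑ xs f + ∑ ys f
  ∑-++ [] ys f = refl
  ∑-++ (x ∷ xs) ys f rewrite ∑-++ xs ys f = sym (+-assoc (f x) _ _)

  ∑-boolFilter-≤ : (p : A → Bool) (xs : List A) (f : A → ℕ) → ∑ (boolFilter p xs) f ≤ ∑ xs f
  ∑-boolFilter-≤ p [] f = z≤n
  ∑-boolFilter-≤ p (x ∷ xs) f with p x
  ... | true = +-monoʳ-≤ (f x) (∑-boolFilter-≤ p xs f)
  ... | false = ≤-trans (∑-boolFilter-≤ p xs f) (m≤n+m _ (f x))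

  length-boolFilter : (p : A → Bool) (xs : List A) → length (boolFilter p xs) ≡ ∑[ x ∈ xs ] ind (p x)
  length-boolFilter p [] = refl
  length-boolFilter p (x ∷ xs) with p x
  ... | true = cong suc (length-boolFilter p xs)
  ... | false = length-boolFilter p xs

module _ {A B : Set} where

  ∑-map : (g : A → B) (xs : List A) (f : B → ℕ) → ∑ (map g xs) f ≡ ∑ xs (f ∘ g)
  ∑-map g [] f = refl
  ∑-map g (x ∷ xs) f = cong (f (g x) +_) (∑-map g xs f)

  ∑-concatMap : (g : A → List B) (xs : List A) (f : B → ℕ) →
                ∑ (concatMap g xs) f ≡ ∑[ x ∈ xs ] ∑ (g x) f
  ∑-concatMap g [] f = refl
  ∑-concatMap g (x ∷ xs) f = trans (∑-++ (g x) (concatMap g xs) f) (cong (∑ (g x) f +_) (∑-concatMap g xs f))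

  length-concatMap : (g : A → List B) (xs : List A) → length (concatMap g xs) ≡ ∑[ x ∈ xs ] length (g x)
  length-concatMap g [] = refl
  length-concatMap g (x ∷ xs) = trans (length-++ (g x)) (cong (length (g x) +_) (length-concatMap g xs))

  ∑-comm : (xs : List A) (ys : List B) (f : A → B → ℕ) →
           ∑[ x ∈ xs ] ∑[ y ∈ ys ] f x y ≡ ∑[ y ∈ ys ] ∑[ x ∈ xs ] f x y
  ∑-comm [] ys f = sym (∑-zero ys)
    where ∑-zero : (ys : List B) → ∑[ y ∈ ys ] 0 ≡ 0
          ∑-zero [] = refl
          ∑-zero (y ∷ ys) = ∑-zero ys
  ∑-comm (x ∷ xs) ys f = trans (cong (∑ ys (f x) +_) (∑-comm xs ys f))
                                (sym (∑-distrib-+ ys (f x) (λ y → ∑[ x ∈ xs ] f x y)))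

∑-tabulate : ∀ {A : Set} n (g : Fin n → A) (f : A → ℕ) → ∑ (tabulate g) f ≡ ∑ (allFin n) (f ∘ g)
∑-tabulate zero g f = refl
∑-tabulate (suc n) g f =
  cong (f (g Fin.zero) +_) (trans (∑-tabulate n (g ∘ Fin.suc) f) (sym (∑-tabulate n Fin.suc (f ∘ g))))

∑-allFin-suc : ∀ n (f : Fin (suc n) → ℕ) → ∑ (allFin (suc n)) f ≡ f Fin.zero + ∑[ i ∈ allFin n ] f (Fin.suc i)
∑-allFin-suc n f = cong (f Fin.zero +_) (∑-tabulate n Fin.suc f)

∑< : ℕ → (ℕ → ℕ) → ℕ
∑< zero f = 0
∑< (suc n) f = f 0 + ∑< n (f ∘ suc)

syntax ∑< n (λ q → e) = ∑[ q < n ] e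

∑<-cong : ∀ n {f g : ℕ → ℕ} → (∀ q → f q ≡ g q) → ∑< n f ≡ ∑< n g
∑<-cong zero f≡g = refl
∑<-cong (suc n) f≡g = cong₂ _+_ (f≡g 0) (∑<-cong n (f≡g ∘ suc))

∑<-distrib-+ : ∀ n (f g : ℕ → ℕ) → ∑[ q < n ] (f q + g q) ≡ ∑< n f + ∑< n g
∑<-distrib-+ zero f g = refl
∑<-distrib-+ (suc n) f g rewrite ∑<-distrib-+ n (f ∘ suc) (g ∘ suc) = +-interchange (f 0) (g 0) _ _

∑<-distribˡ-* : ∀ n c (f : ℕ → ℕ) → ∑[ q < n ] (c * f q) ≡ c * ∑< n f
∑<-distribˡ-* zero c f = sym (*-zeroʳ c)
∑<-distribˡ-* (suc n) c f rewrite ∑<-distribˡ-* n c (f ∘ suc) = sym (*-distribˡ-+ c (f 0) _)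

∑<-suc : ∀ n (f : ℕ → ℕ) → ∑< (suc n) f ≡ ∑< n f + f n
∑<-suc zero f = +-identityʳ (f 0)
∑<-suc (suc n) f rewrite ∑<-suc n (f ∘ suc) = sym (+-assoc (f 0) _ _)

-- Σ 2^-(q+1) ≤ 1, scaled by Y.
∑<-geometric-≤ : ∀ n (f : ℕ → ℕ) Y → (∀ q → 2 ^ suc q * f q ≤ Y) → ∑< n f ≤ Y
∑<-geometric-≤ zero f Y bound = z≤n
∑<-geometric-≤ (suc n) f Y bound = *-cancelˡ-≤ 2 (begin
    2 * (f 0 + ∑< n (f ∘ suc))            ≡⟨ *-distribˡ-+ 2 (f 0) _ ⟩
    2 * f 0 + 2 * ∑< n (f ∘ suc)          ≡⟨ cong (2 * f 0 +_) (∑<-distribˡ-* n 2 (f ∘ suc)) ⟨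
    2 * f 0 + ∑[ q < n ] (2 * f (suc q))  ≤⟨ +-mono-≤ head (∑<-geometric-≤ n (λ q → 2 * f (suc q)) Y tail) ⟩
    Y + Y                                 ≡⟨ +-*-two Y ⟩
    2 * Y                                 ∎)
  where
    open ≤-Reasoning
    +-*-two : ∀ y → y + y ≡ 2 * y
    +-*-two = solve-∀
    head : 2 * f 0 ≤ Y
    head = bound 0
    tail : ∀ q → 2 ^ suc q * (2 * f (suc q)) ≤ Y
    tail q = subst (_≤ Y) (reassoc (2 ^ q) (f (suc q))) (bound (suc q))
      where reassoc : ∀ p x → 2 * (2 * p) * x ≡ 2 * p * (2 * x)
            reassoc = solve-∀

C-pascal : ∀ n k → suc n C suc k ≡ n C k + n C suc k
C-pascal n k = sym (nCk+nC[k+1]≡[n+1]C[k+1] n k)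

nCk≤[1+n]Ck : ∀ n k → n C k ≤ suc n C k
nCk≤[1+n]Ck n zero = ≤-refl
nCk≤[1+n]Ck n (suc k) = ≤-trans (m≤n+m (n C suc k) (n C k)) (≤-reflexive (sym (C-pascal n k)))

C-monoˡ-≤ : ∀ k {n n′} → n ≤ n′ → n C k ≤ n′ C k
C-monoˡ-≤ k {n} n≤n′ with m≤n⇒∃[o]m+o≡n n≤n′
... | o , refl = go o
  where
  go : ∀ o → n C k ≤ (n + o) C k
  go zero rewrite +-identityʳ n = ≤-refl
  go (suc o) rewrite +-suc n o = ≤-trans (go o) (nCk≤[1+n]Ck (n + o) k)

C-absorb : ∀ n k → suc k * (suc n C suc k) ≡ suc n * (n C k)
C-absorb zero zero = refl
C-absorb zero (suc k) = *-zeroʳ (suc (suc k))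
C-absorb (suc n) zero = trans (*-identityˡ _) (trans (nC1≡n (suc (suc n))) (sym (*-identityʳ _)))
C-absorb (suc n) (suc k) = begin
    suc (suc k) * (suc (suc n) C suc (suc k))
      ≡⟨ cong (suc (suc k) *_) (C-pascal (suc n) (suc k)) ⟩
    suc (suc k) * (a + b)
      ≡⟨ split a b k ⟩
    a + suc k * a + suc (suc k) * b
      ≡⟨ cong₂ (λ x y → a + x + y) (C-absorb n k) (C-absorb n (suc k)) ⟩
    a + suc n * (n C k) + suc n * (n C suc k)
      ≡⟨ merge a (n C k) (n C suc k) n ⟩
    a + suc n * (n C k + n C suc k)
      ≡⟨ cong (λ x → a + suc n * x) (C-pascal n k) ⟨
    suc (suc n) * (suc n C suc k) ∎
  where
    open ≡-Reasoning
    a : ℕ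
    a = suc n C suc k
    b : ℕ
    b = suc n C suc (suc k)
    split : ∀ a b k → suc (suc k) * (a + b) ≡ a + suc k * a + suc (suc k) * b
    split = solve-∀
    merge : ∀ a x y n → a + suc n * x + suc n * y ≡ a + suc n * (x + y)
    merge = solve-∀

-- Bernoulli-type estimate (1 + 1/k)^j ≤ k/(k - j), with d = k - j.
[1+k]^j*d≤k^[1+j] : ∀ k j d → j + d ≡ k → suc k ^ j * d ≤ k ^ suc j
[1+k]^j*d≤k^[1+j] k zero d refl = ≤-reflexive (trans (*-identityˡ d) (sym (*-identityʳ d)))
[1+k]^j*d≤k^[1+j] k (suc j) d j+d≡k = begin
    suc k ^ suc j * d        ≡⟨ xy∙z≈xz∙y (suc k) (suc k ^ j) d ⟩
    suc k * d * suc k ^ j    ≤⟨ *-monoˡ-≤ (suc k ^ j) [1+k]d≤k[1+d] ⟩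
    k * suc d * suc k ^ j    ≡⟨ xy∙z≈x∙zy k (suc d) (suc k ^ j) ⟩
    k * (suc k ^ j * suc d)  ≤⟨ *-monoʳ-≤ k ([1+k]^j*d≤k^[1+j] k j (suc d) (trans (+-suc j d) j+d≡k)) ⟩
    k * k ^ suc j            ∎
  where
    open ≤-Reasoning
    [1+k]d≤k[1+d] : suc k * d ≤ k * suc d
    [1+k]d≤k[1+d] = begin
      d + k * d  ≤⟨ +-monoˡ-≤ (k * d) (≤-trans (m≤n+m d (suc j)) (≤-reflexive j+d≡k)) ⟩
      k + k * d  ≡⟨ *-suc k d ⟨
      k * suc d  ∎

[1+k]^h≤2*k^h : ∀ k h d → .{{NonZero k}} → h + d ≡ k → k ≤ 2 * d → suc k ^ h ≤ 2 * k ^ h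
[1+k]^h≤2*k^h k h d h+d≡k k≤2d = *-cancelˡ-≤ k (begin
    k * suc k ^ h        ≤⟨ *-monoˡ-≤ (suc k ^ h) k≤2d ⟩
    2 * d * suc k ^ h    ≡⟨ xy∙z≈x∙zy 2 d (suc k ^ h) ⟩
    2 * (suc k ^ h * d)  ≤⟨ *-monoʳ-≤ 2 ([1+k]^j*d≤k^[1+j] k h d h+d≡k) ⟩
    2 * (k * k ^ h)      ≡⟨ x∙yz≈y∙xz 2 k (k ^ h) ⟩
    k * (2 * k ^ h)      ∎)
  where open ≤-Reasoning

even⊎odd : ∀ k → ∃[ h ] (k ≡ h + h ⊎ k ≡ suc (h + h))
even⊎odd zero = 0 , inj₁ refl
even⊎odd (suc k) with even⊎odd k
... | h , inj₁ refl = h , inj₂ refl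
... | h , inj₂ refl = suc h , inj₁ (cong suc (sym (+-suc h h)))

[1+k]^k≤8*k^k : ∀ k → suc k ^ k ≤ 8 * k ^ k
[1+k]^k≤8*k^k zero = s≤s z≤n
[1+k]^k≤8*k^k k@(suc k′) with even⊎odd k
... | h , inj₁ k≡h+h = begin
    suc k ^ k               ≡⟨ cong (suc k ^_) k≡h+h ⟩
    suc k ^ (h + h)         ≡⟨ ^-distribˡ-+-* (suc k) h h ⟩
    suc k ^ h * suc k ^ h   ≤⟨ *-mono-≤ half half ⟩
    2 * k ^ h * (2 * k ^ h) ≡⟨ regroup (k ^ h) ⟩
    4 * (k ^ h * k ^ h)     ≡⟨ cong (4 *_) (^-distribˡ-+-* k h h) ⟨
    4 * k ^ (h + h)         ≡⟨ cong (λ x → 4 * k ^ x) k≡h+h ⟨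
    4 * k ^ k               ≤⟨ *-monoˡ-≤ (k ^ k) (≤ᵇ⇒≤ 4 8 _) ⟩
    8 * k ^ k               ∎
  where
    open ≤-Reasoning
    half : suc k ^ h ≤ 2 * k ^ h
    half = [1+k]^h≤2*k^h k h h (sym k≡h+h) (≤-reflexive (trans k≡h+h (cong (h +_) (sym (+-identityʳ h)))))
    regroup : ∀ x → 2 * x * (2 * x) ≡ 4 * (x * x)
    regroup = solve-∀
... | h , inj₂ k≡1+h+h = begin
    suc k ^ k                          ≡⟨ cong (suc k ^_) k≡1+h+h ⟩
    suc k * (suc k ^ (h + h))          ≡⟨ cong (suc k *_) (^-distribˡ-+-* (suc k) h h) ⟩
    suc k * (suc k ^ h * suc k ^ h)    ≤⟨ *-mono-≤ 1+k≤2k (*-mono-≤ half half) ⟩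
    2 * k * (2 * k ^ h * (2 * k ^ h))  ≡⟨ regroup k (k ^ h) ⟩
    8 * (k * (k ^ h * k ^ h))          ≡⟨ cong (λ x → 8 * (k * x)) (^-distribˡ-+-* k h h) ⟨
    8 * (k * k ^ (h + h))              ≡⟨ cong (λ x → 8 * k ^ x) k≡1+h+h ⟨
    8 * k ^ k                          ∎
  where
    open ≤-Reasoning
    half : suc k ^ h ≤ 2 * k ^ h
    half = [1+k]^h≤2*k^h k h (suc h) (trans (+-suc h h) (sym k≡1+h+h))
             (≤-trans (≤-reflexive k≡1+h+h) (≤-trans (n≤1+n _) (≤-reflexive (double h))))
      where double : ∀ h → suc (suc (h + h)) ≡ 2 * suc h
            double = solve-∀
    1+k≤2k : suc k ≤ 2 * k
    1+k≤2k = ≤-trans (+-monoˡ-≤ k (s≤s z≤n)) (≤-reflexive (cong (k +_) (sym (+-identityʳ k))))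
    regroup : ∀ k x → 2 * k * (2 * x * (2 * x)) ≡ 8 * (k * (x * x))
    regroup = solve-∀

k^k*nCk≤8^k*n^k : ∀ k n → k ^ k * (n C k) ≤ 8 ^ k * n ^ k
k^k*nCk≤8^k*n^k zero n = ≤-refl
k^k*nCk≤8^k*n^k (suc k) zero = ≤-trans (≤-reflexive (*-zeroʳ (suc k ^ suc k))) z≤n
k^k*nCk≤8^k*n^k (suc k) (suc n) = begin
    suc k ^ suc k * (suc n C suc k)    ≡⟨ xy∙z≈y∙xz (suc k) (suc k ^ k) (suc n C suc k) ⟩
    suc k ^ k * (suc k * (suc n C suc k)) ≡⟨ cong (suc k ^ k *_) (C-absorb n k) ⟩
    suc k ^ k * (suc n * (n C k))        ≤⟨ *-monoˡ-≤ (suc n * (n C k)) ([1+k]^k≤8*k^k k) ⟩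
    8 * k ^ k * (suc n * (n C k))        ≡⟨ regroup′ (k ^ k) (suc n) (n C k) ⟩
    8 * suc n * (k ^ k * (n C k))        ≤⟨ *-monoʳ-≤ (8 * suc n) (k^k*nCk≤8^k*n^k k n) ⟩
    8 * suc n * (8 ^ k * n ^ k)        ≤⟨ *-monoʳ-≤ (8 * suc n) (*-monoʳ-≤ (8 ^ k) (^-monoˡ-≤ k (n≤1+n n))) ⟩
    8 * suc n * (8 ^ k * suc n ^ k)    ≡⟨ regroup″ (suc n) (8 ^ k) (suc n ^ k) ⟩
    8 ^ suc k * suc n ^ suc k          ∎
  where
    open ≤-Reasoning
    regroup′ : ∀ x a c → 8 * x * (a * c) ≡ 8 * a * (x * c)
    regroup′ = solve-∀
    regroup″ : ∀ a p q → 8 * a * (p * q) ≡ 8 * p * (a * q)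
    regroup″ = solve-∀

-- The number of m-subsets of an N-set containing a fixed t-subset: (N ∸ t) C (m ∸ t) if t ≤ N, t ≤ m, else 0.
supersets : ℕ → ℕ → ℕ → ℕ
supersets N zero m = N C m
supersets zero (suc t) m = 0
supersets (suc N) (suc t) zero = 0
supersets (suc N) (suc t) (suc m) = supersets N t m

supersets-monoˡ : ∀ N t m → supersets N t m ≤ supersets (suc N) t m
supersets-monoˡ N zero m = nCk≤[1+n]Ck N m
supersets-monoˡ zero (suc t) m = z≤n
supersets-monoˡ (suc N) (suc t) zero = z≤n
supersets-monoˡ (suc N) (suc t) (suc m) = supersets-monoˡ N t m

supersets-pascal : ∀ N t m → supersets N t m + supersets N t (suc m) ≤ supersets (suc N) t (suc m)
supersets-pascal N zero m = ≤-reflexive (sym (C-pascal N m))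
supersets-pascal zero (suc t) m = z≤n
supersets-pascal (suc N) (suc t) zero = supersets-monoˡ N t 0
supersets-pascal (suc N) (suc t) (suc m) = supersets-pascal N t m

supersets-bound : ∀ N t m → supersets N t m * (N ∸ t) ^ t ≤ (N C m) * m ^ t
supersets-bound N zero m = ≤-refl
supersets-bound zero (suc t) m = z≤n
supersets-bound (suc N) (suc t) zero = z≤n
supersets-bound (suc N) (suc t) (suc m) = begin
    supersets N t m * ((N ∸ t) * (N ∸ t) ^ t)  ≡⟨ x∙yz≈y∙xz (supersets N t m) (N ∸ t) ((N ∸ t) ^ t) ⟩
    (N ∸ t) * (supersets N t m * (N ∸ t) ^ t)  ≤⟨ *-mono-≤ (m∸n≤m N t) (supersets-bound N t m) ⟩
    N * ((N C m) * m ^ t)                        ≤⟨ *-mono-≤ (n≤1+n N) (*-monoʳ-≤ (N C m) (^-monoˡ-≤ t (n≤1+n m))) ⟩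
    suc N * ((N C m) * suc m ^ t)                ≡⟨ *-assoc (suc N) (N C m) (suc m ^ t) ⟨
    suc N * (N C m) * suc m ^ t                  ≡⟨ cong (_* suc m ^ t) (C-absorb N m) ⟨
    suc m * (suc N C suc m) * suc m ^ t          ≡⟨ xy∙z≈y∙xz (suc m) (suc N C suc m) (suc m ^ t) ⟩
    (suc N C suc m) * (suc m * suc m ^ t)        ∎
  where open ≤-Reasoning

∑-allVecs-suc : ∀ N (f : Vec Bool (suc N) → ℕ) →
                ∑ (allVecs (suc N)) f ≡ ∑[ v ∈ allVecs N ] (f (true Vec.∷ v) + f (false Vec.∷ v))
∑-allVecs-suc N f = trans (∑-concatMap _ (allVecs N) f)
  (∑-cong (allVecs N) (λ v → cong (f (true Vec.∷ v) +_) (+-identityʳ (f (false Vec.∷ v)))))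

#card≡ : ∀ N m → ∑[ v ∈ allVecs N ] ind (card v ≡ᵇ m) ≡ N C m
#card≡ zero zero = refl
#card≡ zero (suc m) = refl
#card≡ (suc N) zero = trans (∑-allVecs-suc N (λ v → ind (card v ≡ᵇ 0))) (#card≡ N zero)
#card≡ (suc N) (suc m) = begin
    ∑ (allVecs (suc N)) (λ v → ind (card v ≡ᵇ suc m))
      ≡⟨ ∑-allVecs-suc N (λ v → ind (card v ≡ᵇ suc m)) ⟩
    ∑[ v ∈ allVecs N ] (ind (card v ≡ᵇ m) + ind (card v ≡ᵇ suc m))
      ≡⟨ ∑-distrib-+ (allVecs N) _ _ ⟩
    ∑[ v ∈ allVecs N ] ind (card v ≡ᵇ m) + ∑[ v ∈ allVecs N ] ind (card v ≡ᵇ suc m)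
      ≡⟨ cong₂ _+_ (#card≡ N m) (#card≡ N (suc m)) ⟩
    N C m + N C suc m
      ≡⟨ C-pascal N m ⟨
    suc N C suc m ∎
  where open ≡-Reasoning

∑-allVecs-by-card : ∀ N (g : ℕ → ℕ) → ∑[ v ∈ allVecs N ] g (card v) ≡ ∑[ q < suc N ] ((N C q) * g q)
∑-allVecs-by-card zero g = cong (_+ 0) (sym (*-identityˡ (g 0)))
∑-allVecs-by-card (suc N) g = begin
    ∑ (allVecs (suc N)) (λ v → g (card v))
      ≡⟨ ∑-allVecs-suc N (λ v → g (card v)) ⟩
    ∑[ v ∈ allVecs N ] (g (suc (card v)) + g (card v))
      ≡⟨ ∑-distrib-+ (allVecs N) (λ v → g (suc (card v))) (λ v → g (card v)) ⟩
    ∑[ v ∈ allVecs N ] g (suc (card v)) + ∑[ v ∈ allVecs N ] g (card v)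
      ≡⟨ cong₂ _+_ (∑-allVecs-by-card N (λ q → g (suc q))) (∑-allVecs-by-card N g) ⟩
    A + (1 * g 0 + B)
      ≡⟨ x+[y+z]≡y+[x+z] A (1 * g 0) B ⟩
    1 * g 0 + (A + B)
      ≡⟨ cong (λ x → 1 * g 0 + (A + x)) B≡B′ ⟩
    1 * g 0 + (A + ∑[ q < suc N ] ((N C suc q) * g (suc q)))
      ≡⟨ cong (1 * g 0 +_) (∑<-distrib-+ (suc N) (λ q → (N C q) * g (suc q)) (λ q → (N C suc q) * g (suc q))) ⟨
    1 * g 0 + ∑[ q < suc N ] ((N C q) * g (suc q) + (N C suc q) * g (suc q))
      ≡⟨ cong (1 * g 0 +_) (∑<-cong (suc N) pascal) ⟩
    1 * g 0 + ∑[ q < suc N ] ((suc N C suc q) * g (suc q)) ∎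
  where
    open ≡-Reasoning
    A : ℕ
    A = ∑[ q < suc N ] ((N C q) * g (suc q))
    B : ℕ
    B = ∑[ q < N ] ((N C suc q) * g (suc q))
    B≡B′ : B ≡ ∑[ q < suc N ] ((N C suc q) * g (suc q))
    B≡B′ = sym (begin
      ∑[ q < suc N ] ((N C suc q) * g (suc q))  ≡⟨ ∑<-suc N (λ q → (N C suc q) * g (suc q)) ⟩
      B + (N C suc N) * g (suc N)             ≡⟨ cong (λ x → B + x * g (suc N)) (k>n⇒nCk≡0 (n<1+n N)) ⟩
      B + 0                                   ≡⟨ +-identityʳ B ⟩
      B                                       ∎)
    pascal : ∀ q → (N C q) * g (suc q) + (N C suc q) * g (suc q) ≡ (suc N C suc q) * g (suc q)
    pascal q = trans (sym (*-distribʳ-+ (g (suc q)) (N C q) (N C suc q))) (cong (_* g (suc q)) (sym (C-pascal N q)))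

selected : {E : Set} (es : List E) (p : E → Bool) → Vec Bool (length es) → ℕ
selected es p G = length (boolFilter (λ eb → proj₂ eb ∧ p (proj₁ eb)) (zip es (toList G)))

atLeastCount : {E : Set} (es : List E) (p : E → Bool) (t m : ℕ) → ℕ
atLeastCount es p t m = ∑[ G ∈ allVecs (length es) ] (ind (card G ≡ᵇ m) * ind (t ≤ᵇ selected es p G))

length-if : {A : Set} (b : Bool) (x : A) (xs : List A) → length (if b then x ∷ xs else xs) ≡ ind b + length xs
length-if true x xs = refl
length-if false x xs = refl

suc≤ᵇsuc : ∀ t s → (suc t ≤ᵇ suc s) ≡ (t ≤ᵇ s)
suc≤ᵇsuc zero s = refl
suc≤ᵇsuc (suc t) s = refl

suc≤ᵇ-ind : ∀ b t s → (suc t ≤ᵇ ind b + s) ≡ ((if b then t else suc t) ≤ᵇ s)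
suc≤ᵇ-ind true t s = suc≤ᵇsuc t s
suc≤ᵇ-ind false t s = refl

module _ {E : Set} (e : E) (es : List E) (p : E → Bool) where

  private
    N : ℕ
    N = length es

  atLeastCount-cons-zero : ∀ t → atLeastCount (e ∷ es) p t 0 ≡ atLeastCount es p t 0
  atLeastCount-cons-zero t = ∑-allVecs-suc N _

  atLeastCount-cons-suc : ∀ t m → atLeastCount (e ∷ es) p (suc t) (suc m) ≡
    atLeastCount es p (if p e then t else suc t) m + atLeastCount es p (suc t) (suc m)
  atLeastCount-cons-suc t m =
    trans (∑-allVecs-suc N _) (trans (∑-distrib-+ (allVecs N) _ _)
          (cong (_+ atLeastCount es p (suc t) (suc m)) (∑-cong (allVecs N) threshold)))
    where
      threshold : ∀ v → ind (card v ≡ᵇ m) * ind (suc t ≤ᵇ selected (e ∷ es) p (true Vec.∷ v))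
                      ≡ ind (card v ≡ᵇ m) * ind ((if p e then t else suc t) ≤ᵇ selected es p v)
      threshold v = cong (λ b → ind (card v ≡ᵇ m) * ind b)
        (trans (cong (suc t ≤ᵇ_) (length-if (p e) _ _)) (suc≤ᵇ-ind (p e) t (selected es p v)))

supersets-zero : ∀ N t → supersets N (suc t) 0 ≡ 0
supersets-zero zero t = refl
supersets-zero (suc N) t = refl

-- Union bound over the t-subsets of {e ∈ es | p e}.
atLeastCount-bound : {E : Set} (es : List E) (p : E → Bool) (t m : ℕ) →
  atLeastCount es p t m ≤ (∑[ e ∈ es ] ind (p e) C t) * supersets (length es) t m
atLeastCount-bound es p zero m = ≤-reflexive (begin
    atLeastCount es p zero m                        ≡⟨ ∑-cong (allVecs (length es)) (λ G → *-identityʳ _) ⟩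
    ∑[ G ∈ allVecs (length es) ] ind (card G ≡ᵇ m)  ≡⟨ #card≡ (length es) m ⟩
    length es C m                                   ≡⟨ *-identityˡ _ ⟨
    1 * (length es C m)                             ∎)
  where open ≡-Reasoning
atLeastCount-bound [] p (suc t) m = ≤-trans (≤-reflexive (trans (+-identityʳ _) (*-zeroʳ (ind (0 ≡ᵇ m))))) z≤n
atLeastCount-bound (e ∷ es) p (suc t) zero = begin
    atLeastCount (e ∷ es) p (suc t) 0        ≡⟨ atLeastCount-cons-zero e es p (suc t) ⟩
    atLeastCount es p (suc t) 0              ≤⟨ atLeastCount-bound es p (suc t) 0 ⟩
    (c C suc t) * supersets (length es) (suc t) 0 ≡⟨ cong ((c C suc t) *_) (supersets-zero (length es) t) ⟩
    (c C suc t) * 0                          ≡⟨ *-zeroʳ (c C suc t) ⟩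
    0                                        ≤⟨ z≤n ⟩
    _                                        ∎
  where
    open ≤-Reasoning
    c : ℕ
    c = ∑[ x ∈ es ] ind (p x)
atLeastCount-bound (e ∷ es) p (suc t) (suc m) = begin
    atLeastCount (e ∷ es) p (suc t) (suc m)
      ≡⟨ atLeastCount-cons-suc e es p t m ⟩
    atLeastCount es p (t′ (p e)) m + atLeastCount es p (suc t) (suc m)
      ≤⟨ +-mono-≤ (atLeastCount-bound es p (t′ (p e)) m) (atLeastCount-bound es p (suc t) (suc m)) ⟩
    (c C t′ (p e)) * S N (t′ (p e)) m + (c C suc t) * S N (suc t) (suc m)
      ≤⟨ pascal (p e) ⟩
    ((ind (p e) + c) C suc t) * S (suc N) (suc t) (suc m) ∎
  where
    open ≤-Reasoning
    N : ℕ
    N = length es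
    S : ℕ → ℕ → ℕ → ℕ
    S = supersets
    c : ℕ
    c = ∑[ x ∈ es ] ind (p x)
    t′ : Bool → ℕ
    t′ b = if b then t else suc t
    pascal : ∀ b → (c C t′ b) * S N (t′ b) m + (c C suc t) * S N (suc t) (suc m)
                   ≤ ((ind b + c) C suc t) * S (suc N) (suc t) (suc m)
    pascal true = begin
      (c C t) * S N t m + (c C suc t) * S N (suc t) (suc m)
        ≤⟨ +-monoʳ-≤ ((c C t) * S N t m) (*-monoʳ-≤ (c C suc t) (supersets-monoˡ N (suc t) (suc m))) ⟩
      (c C t) * S N t m + (c C suc t) * S N t m
        ≡⟨ *-distribʳ-+ (S N t m) (c C t) (c C suc t) ⟨
      (c C t + c C suc t) * S N t m
        ≡⟨ cong (_* S N t m) (C-pascal c t) ⟨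
      (suc c C suc t) * S N t m ∎
    pascal false = begin
      (c C suc t) * S N (suc t) m + (c C suc t) * S N (suc t) (suc m)
        ≡⟨ *-distribˡ-+ (c C suc t) (S N (suc t) m) (S N (suc t) (suc m)) ⟨
      (c C suc t) * (S N (suc t) m + S N (suc t) (suc m))
        ≤⟨ *-monoʳ-≤ (c C suc t) (supersets-pascal N (suc t) m) ⟩
      (c C suc t) * S (suc N) (suc t) (suc m) ∎

private
  ordered : ∀ {n} → Fin n × Fin n → Bool
  ordered e = toℕ (proj₁ e) <ᵇ toℕ (proj₂ e)

  row : ∀ n → Fin n → List (Fin n × Fin n)
  row n i = map (i ,_) (allFin n)

inside : ∀ {n} → Vec Bool n → Fin n × Fin n → Bool
inside S e = lookup S (proj₁ e) ∧ lookup S (proj₂ e)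

ind-∧ : ∀ a b → ind (a ∧ b) ≡ ind a * ind b
ind-∧ true b = sym (+-identityʳ (ind b))
ind-∧ false b = refl

∑-allFin-1 : ∀ n → ∑[ i ∈ allFin n ] 1 ≡ n
∑-allFin-1 zero = refl
∑-allFin-1 (suc n) = trans (∑-allFin-suc n (λ _ → 1)) (cong suc (∑-allFin-1 n))

∑-allFin-lookup : ∀ n (S : Vec Bool n) → ∑[ i ∈ allFin n ] ind (lookup S i) ≡ card S
∑-allFin-lookup zero Vec.[] = refl
∑-allFin-lookup (suc n) (b Vec.∷ S) =
  trans (∑-allFin-suc n (ind ∘ lookup (b Vec.∷ S))) (trans (cong (ind b +_) (∑-allFin-lookup n S)) (lemma b))
  where lemma : ∀ b → ind b + card S ≡ card (b Vec.∷ S)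
        lemma true = refl
        lemma false = refl

#above : ∀ n c → ∑[ j ∈ allFin n ] ind (c <ᵇ toℕ j) ≡ n ∸ suc c
#above zero c = refl
#above (suc n) zero = trans (∑-allFin-suc n (λ j → ind (0 <ᵇ toℕ j))) (∑-allFin-1 n)
#above (suc n) (suc c) = trans (∑-allFin-suc n (λ j → ind (suc c <ᵇ toℕ j))) (#above n c)

numEdges≡∑ : ∀ n → numEdges n ≡ ∑[ i ∈ allFin n ] (n ∸ suc (toℕ i))
numEdges≡∑ n = trans (length-concatMap _ (allFin n)) (∑-cong (allFin n) λ i → begin
    length (boolFilter ordered (row n i))          ≡⟨ length-boolFilter ordered (row n i) ⟩
    ∑[ e ∈ row n i ] ind (ordered e)                 ≡⟨ ∑-map (i ,_) (allFin n) (ind ∘ ordered) ⟩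
    ∑[ j ∈ allFin n ] ind (toℕ i <ᵇ toℕ j)           ≡⟨ #above n (toℕ i) ⟩
    n ∸ suc (toℕ i)                                  ∎)
  where open ≡-Reasoning

2*numEdges+n≡n² : ∀ n → 2 * numEdges n + n ≡ n * n
2*numEdges+n≡n² n = trans (cong (λ x → 2 * x + n) (numEdges≡∑ n)) (go n)
  where
    go : ∀ n → 2 * ∑[ i ∈ allFin n ] (n ∸ suc (toℕ i)) + n ≡ n * n
    go zero = refl
    go (suc n) = begin
      2 * ∑[ i ∈ allFin (suc n) ] (suc n ∸ suc (toℕ i)) + suc n
        ≡⟨ cong (λ x → 2 * x + suc n) (∑-allFin-suc n (λ i → suc n ∸ suc (toℕ i))) ⟩
      2 * (n + s) + suc n  ≡⟨ expand n s ⟩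
      (2 * s + n) + 2 * n + 1  ≡⟨ cong (λ x → x + 2 * n + 1) (go n) ⟩
      n * n + 2 * n + 1    ≡⟨ square n ⟩
      suc n * suc n        ∎
      where
        open ≡-Reasoning
        s : ℕ
        s = ∑[ i ∈ allFin n ] (n ∸ suc (toℕ i))
        expand : ∀ n s → 2 * (n + s) + suc n ≡ (2 * s + n) + 2 * n + 1
        expand = solve-∀
        square : ∀ n → n * n + 2 * n + 1 ≡ suc n * suc n
        square = solve-∀

edges-inside-≤ : ∀ n (S : Vec Bool n) → ∑[ e ∈ edgeList n ] ind (inside S e) ≤ card S * card S
edges-inside-≤ n S = begin
    ∑[ e ∈ edgeList n ] ind (inside S e)
      ≡⟨ ∑-concatMap _ (allFin n) (ind ∘ inside S) ⟩
    ∑[ i ∈ allFin n ] ∑ (boolFilter ordered (row n i)) (ind ∘ inside S)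
      ≤⟨ ∑-mono-≤ (allFin n) (λ i → ∑-boolFilter-≤ ordered (row n i) (ind ∘ inside S)) ⟩
    ∑[ i ∈ allFin n ] ∑ (row n i) (ind ∘ inside S)
      ≡⟨ ∑-cong (allFin n) rowSum ⟩
    ∑[ i ∈ allFin n ] (card S * ind (lookup S i))
      ≡⟨ ∑-distribˡ-* (allFin n) (card S) _ ⟩
    card S * ∑[ i ∈ allFin n ] ind (lookup S i)
      ≡⟨ cong (card S *_) (∑-allFin-lookup n S) ⟩
    card S * card S ∎
  where
    open ≤-Reasoning
    rowSum : ∀ i → ∑ (row n i) (ind ∘ inside S) ≡ card S * ind (lookup S i)
    rowSum i = begin-equality
      ∑ (row n i) (ind ∘ inside S)
        ≡⟨ ∑-map (i ,_) (allFin n) (ind ∘ inside S) ⟩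
      ∑[ j ∈ allFin n ] ind (lookup S i ∧ lookup S j)
        ≡⟨ ∑-cong (allFin n) (λ j → ind-∧ (lookup S i) (lookup S j)) ⟩
      ∑[ j ∈ allFin n ] (ind (lookup S i) * ind (lookup S j))
        ≡⟨ ∑-distribˡ-* (allFin n) (ind (lookup S i)) (ind ∘ lookup S) ⟩
      ind (lookup S i) * ∑[ j ∈ allFin n ] ind (lookup S j)
        ≡⟨ cong (ind (lookup S i) *_) (∑-allFin-lookup n S) ⟩
      ind (lookup S i) * card S
        ≡⟨ *-comm (ind (lookup S i)) (card S) ⟩
      card S * ind (lookup S i) ∎

not-≤ᵇ : ∀ s t → not (s ≤ᵇ t) ≡ (suc t ≤ᵇ s)
not-≤ᵇ zero t = refl
not-≤ᵇ (suc s) zero = refl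
not-≤ᵇ (suc s) (suc t) = trans (cong not (suc≤ᵇsuc s t)) (not-≤ᵇ s t)

ind-∧-not-all≤∑ : {A : Set} (b : Bool) (f : A → Bool) (xs : List A) →
  ind (b ∧ not (foldr _∧_ true (map f xs))) ≤ ∑[ x ∈ xs ] ind (b ∧ not (f x))
ind-∧-not-all≤∑ false f xs = z≤n
ind-∧-not-all≤∑ true f [] = z≤n
ind-∧-not-all≤∑ true f (x ∷ xs) with f x
... | true = ind-∧-not-all≤∑ true f xs
... | false = s≤s z≤n

ind-violates≤ : ∀ b c s t → ind (b ∧ not (if c then s ≤ᵇ t else true)) ≤ ind c * (ind b * ind (suc t ≤ᵇ s))
ind-violates≤ false c s t = z≤n
ind-violates≤ true false s t = z≤n
ind-violates≤ true true s t rewrite not-≤ᵇ s t = ≤-reflexive (sym (trans (+-identityʳ _) (+-identityʳ _)))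

-- Bad graphs witnessed by one q-set S: t = 3q + 1 of its at most q² inner pairs are edges.
sizeTerm : (a m n q : ℕ) → ℕ
sizeTerm a m n q = ind (q ≤ᵇ a) * (((q * q) C suc (3 * q)) * supersets (numEdges n) (suc (3 * q)) m)

badCount-bound : ∀ a m n → badCount a m n ≤ ∑[ q < suc n ] ((n C q) * sizeTerm a m n q)
badCount-bound a m n = begin
    badCount a m n
      ≡⟨ length-boolFilter bad (allVecs N) ⟩
    ∑[ G ∈ allVecs N ] ind (bad G)
      ≤⟨ ∑-mono-≤ (allVecs N) bad≤∑ ⟩
    ∑[ G ∈ allVecs N ] ∑[ S ∈ allVecs n ] witness S G
      ≡⟨ ∑-comm (allVecs N) (allVecs n) (λ G S → witness S G) ⟩
    ∑[ S ∈ allVecs n ] ∑[ G ∈ allVecs N ] witness S G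
      ≡⟨ ∑-cong (allVecs n) (λ S → ∑-distribˡ-* (allVecs N) (ind (card S ≤ᵇ a)) _) ⟩
    ∑[ S ∈ allVecs n ] (ind (card S ≤ᵇ a) * atLeastCount (edgeList n) (inside S) (suc (3 * card S)) m)
      ≤⟨ ∑-mono-≤ (allVecs n) (λ S → *-monoʳ-≤ (ind (card S ≤ᵇ a)) (atLeastCount-≤ S)) ⟩
    ∑[ S ∈ allVecs n ] sizeTerm a m n (card S)
      ≡⟨ ∑-allVecs-by-card n (sizeTerm a m n) ⟩
    ∑[ q < suc n ] ((n C q) * sizeTerm a m n q) ∎
  where
    open ≤-Reasoning
    N : ℕ
    N = numEdges n
    bad : Graph n → Bool
    bad G = (card G ≡ᵇ m) ∧ not (goodGraph a n G)
    witness : Vec Bool n → Graph n → ℕ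
    witness S G = ind (card S ≤ᵇ a) * (ind (card G ≡ᵇ m) * ind (suc (3 * card S) ≤ᵇ spanned n S G))
    bad≤∑ : ∀ G → ind (bad G) ≤ ∑[ S ∈ allVecs n ] witness S G
    bad≤∑ G = ≤-trans (ind-∧-not-all≤∑ (card G ≡ᵇ m) _ (allVecs n))
      (∑-mono-≤ (allVecs n) (λ S → ind-violates≤ (card G ≡ᵇ m) (card S ≤ᵇ a) (spanned n S G) (3 * card S)))
    atLeastCount-≤ : ∀ S → atLeastCount (edgeList n) (inside S) (suc (3 * card S)) m
                           ≤ ((card S * card S) C suc (3 * card S)) * supersets N (suc (3 * card S)) m
    atLeastCount-≤ S = ≤-trans (atLeastCount-bound (edgeList n) (inside S) (suc (3 * card S)) m)
      (*-monoˡ-≤ (supersets N (suc (3 * card S)) m) (C-monoˡ-≤ (suc (3 * card S)) (edges-inside-≤ n S)))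

^-distribʳ-* : ∀ m n o → (m * n) ^ o ≡ m ^ o * n ^ o
^-distribʳ-* m n zero = refl
^-distribʳ-* m n (suc o) rewrite ^-distribʳ-* m n o = regroup m n (m ^ o) (n ^ o)
  where regroup : ∀ a b x y → a * b * (x * y) ≡ a * x * (b * y)
        regroup = solve-∀

^[1+3q] : ∀ x q → x ^ suc (3 * q) ≡ x * (x * x * x) ^ q
^[1+3q] x q = cong (x *_) (trans (sym (^-*-assoc x 3 q)) (cong (_^ q) (cube x)))
  where cube : ∀ x → x * (x * (x * 1)) ≡ x * x * x
        cube = solve-∀

-- With y = 8q²m and z = 3qL the two sides are 2cy (16ny³)^q and z (qz³)^q, compared factor by factor.
size-ratio : ∀ c n m q L → 16 * c * q * m ≤ L → 8192 * n * (q * q) * (m * m * m) ≤ L * L * L →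
  let t = suc (3 * q) in
  2 ^ suc q * c * (8 ^ q * n ^ q) * (8 ^ t * (q * q) ^ t * m ^ t) ≤ q ^ q * ((3 * q) ^ t * L ^ t)
size-ratio c n m q L linear cubic = begin
    2 ^ suc q * c * (8 ^ q * n ^ q) * (8 ^ t * (q * q) ^ t * m ^ t)
      ≡⟨ cong (2 ^ suc q * c * (8 ^ q * n ^ q) *_) y^t ⟩
    2 ^ suc q * c * (8 ^ q * n ^ q) * (y * (y * y * y) ^ q)
      ≡⟨ regroup (2 ^ q) c (8 ^ q) (n ^ q) y ((y * y * y) ^ q) ⟩
    (2 * c * y) * (2 ^ q * 8 ^ q * n ^ q * (y * y * y) ^ q)
      ≡⟨ cong ((2 * c * y) *_) collect ⟩
    (2 * c * y) * (16 * n * (y * y * y)) ^ q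
      ≤⟨ *-mono-≤ 2cy≤z (^-monoˡ-≤ q 16ny³≤qz³) ⟩
    z * (q * (z * z * z)) ^ q
      ≡⟨ cong (z *_) (^-distribʳ-* q (z * z * z) q) ⟩
    z * (q ^ q * (z * z * z) ^ q)
      ≡⟨ x∙yz≈y∙xz z (q ^ q) ((z * z * z) ^ q) ⟩
    q ^ q * (z * (z * z * z) ^ q)
      ≡⟨ cong (q ^ q *_) (^[1+3q] z q) ⟨
    q ^ q * (3 * q * L) ^ t
      ≡⟨ cong (q ^ q *_) (^-distribʳ-* (3 * q) L t) ⟩
    q ^ q * ((3 * q) ^ t * L ^ t) ∎
  where
    open ≤-Reasoning
    t : ℕ
    t = suc (3 * q)
    y : ℕ
    y = 8 * (q * q) * m
    z : ℕ
    z = 3 * q * L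
    y^t : 8 ^ t * (q * q) ^ t * m ^ t ≡ y * (y * y * y) ^ q
    y^t = trans (sym (trans (^-distribʳ-* (8 * (q * q)) m t) (cong (_* m ^ t) (^-distribʳ-* 8 (q * q) t))))
                (^[1+3q] y q)
    collect : 2 ^ q * 8 ^ q * n ^ q * (y * y * y) ^ q ≡ (16 * n * (y * y * y)) ^ q
    collect = sym (trans (^-distribʳ-* (16 * n) (y * y * y) q)
                (cong (_* (y * y * y) ^ q) (trans (^-distribʳ-* 16 n q) (cong (_* n ^ q) (^-distribʳ-* 2 8 q)))))
    regroup : ∀ a c b x y w → 2 * a * c * (b * x) * (y * w) ≡ (2 * c * y) * (a * b * x * w)
    regroup = solve-∀
    2cy≤z : 2 * c * y ≤ z
    2cy≤z = begin
      2 * c * (8 * (q * q) * m)  ≡⟨ regroup′ c q m ⟩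
      q * (16 * c * q * m)       ≤⟨ *-monoʳ-≤ q linear ⟩
      q * L                      ≤⟨ m≤n+m (q * L) (2 * q * L) ⟩
      2 * q * L + q * L          ≡⟨ triple q L ⟩
      z                          ∎
      where regroup′ : ∀ c q m → 2 * c * (8 * (q * q) * m) ≡ q * (16 * c * q * m)
            regroup′ = solve-∀
            triple : ∀ q L → 2 * q * L + q * L ≡ 3 * q * L
            triple = solve-∀
    16ny³≤qz³ : 16 * n * (y * y * y) ≤ q * (z * z * z)
    16ny³≤qz³ = begin
      16 * n * (y * y * y)                                 ≡⟨ regroup′ n q m ⟩
      q⁴ * (8192 * n * (q * q) * (m * m * m))              ≤⟨ *-monoʳ-≤ q⁴ cubic ⟩
      q⁴ * (L * L * L)                                     ≤⟨ m≤n+m _ (26 * (q⁴ * (L * L * L))) ⟩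
      26 * (q⁴ * (L * L * L)) + q⁴ * (L * L * L)           ≡⟨ cube q L ⟩
      q * (z * z * z)                                      ∎
      where q⁴ : ℕ
            q⁴ = q * q * q * q
            regroup′ : ∀ n q m → 16 * n * (8 * (q * q) * m * (8 * (q * q) * m) * (8 * (q * q) * m))
                                 ≡ (q * q * q * q) * (8192 * n * (q * q) * (m * m * m))
            regroup′ = solve-∀
            cube : ∀ q L → 26 * ((q * q * q * q) * (L * L * L)) + (q * q * q * q) * (L * L * L)
                           ≡ q * (3 * q * L * (3 * q * L) * (3 * q * L))
            cube = solve-∀

q^q>0 : ∀ q → q ^ q > 0
q^q>0 zero = ≤-refl
q^q>0 (suc q) = m^n>0 (suc q) (suc q)

-- Multiplying by q^q t^t L^t turns each binomial coefficient into a power, via the two binomial estimates.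
term-bound : ∀ c n m q N → let t = suc (3 * q) ; L = N ∸ t in
  1 ≤ L → 16 * c * q * m ≤ L → 8192 * n * (q * q) * (m * m * m) ≤ L * L * L →
  2 ^ suc q * (c * ((n C q) * (((q * q) C t) * supersets N t m))) ≤ N C m
term-bound c n m q N L≥1 linear cubic = *-cancelˡ-≤ P {{>-nonZero P>0}} (begin
    P * (2 ^ suc q * (c * ((n C q) * (((q * q) C t) * supersets N t m))))
      ≡⟨ regroup (q ^ q) (t ^ t) (L ^ t) (2 ^ suc q) c (n C q) ((q * q) C t) (supersets N t m) ⟩
    (2 ^ suc q * c) * ((q ^ q * (n C q)) * ((t ^ t * ((q * q) C t)) * (supersets N t m * L ^ t)))
      ≤⟨ *-monoʳ-≤ (2 ^ suc q * c) (*-mono-≤ (k^k*nCk≤8^k*n^k q n)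
                                   (*-mono-≤ (k^k*nCk≤8^k*n^k t (q * q)) (supersets-bound N t m))) ⟩
    (2 ^ suc q * c) * ((8 ^ q * n ^ q) * ((8 ^ t * (q * q) ^ t) * ((N C m) * m ^ t)))
      ≡⟨ regroup′ (2 ^ suc q * c) (8 ^ q * n ^ q) (8 ^ t) ((q * q) ^ t) (N C m) (m ^ t) ⟩
    (2 ^ suc q * c * (8 ^ q * n ^ q) * (8 ^ t * (q * q) ^ t * m ^ t)) * (N C m)
      ≤⟨ *-monoˡ-≤ (N C m) (size-ratio c n m q L linear cubic) ⟩
    (q ^ q * ((3 * q) ^ t * L ^ t)) * (N C m)
      ≤⟨ *-monoˡ-≤ (N C m) (*-monoʳ-≤ (q ^ q) (*-monoˡ-≤ (L ^ t) (^-monoˡ-≤ t (n≤1+n (3 * q))))) ⟩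
    P * (N C m) ∎)
  where
    open ≤-Reasoning
    t : ℕ
    t = suc (3 * q)
    L : ℕ
    L = N ∸ t
    P : ℕ
    P = q ^ q * (t ^ t * L ^ t)
    P>0 : P > 0
    P>0 = *-mono-≤ (q^q>0 q) (*-mono-≤ (m^n>0 t t) (≤-trans (≤-reflexive (sym (^-zeroˡ t))) (^-monoˡ-≤ t L≥1)))
    regroup : ∀ Q T Lt A k c1 c2 d → Q * (T * Lt) * (A * (k * (c1 * (c2 * d))))
                                     ≡ (A * k) * ((Q * c1) * ((T * c2) * (d * Lt)))
    regroup = solve-∀
    regroup′ : ∀ A B c d x y → A * (B * ((c * d) * (x * y))) ≡ (A * B * (c * d * y)) * x
    regroup′ = solve-∀

n²≤4[numEdges∸t] : ∀ n t → 15 ≤ n → t ≤ suc (3 * n) → n * n ≤ 4 * (numEdges n ∸ t)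
n²≤4[numEdges∸t] n t 15≤n t≤1+3n = begin
    n * n                ≤⟨ m+n≤o⇒m≤o∸n (n * n) n²+4t≤4N ⟩
    4 * N ∸ 4 * t        ≡⟨ *-distribˡ-∸ 4 N t ⟨
    4 * (N ∸ t)          ∎
  where
    open ≤-Reasoning
    N : ℕ
    N = numEdges n
    4t+2n≤n² : 4 * t + 2 * n ≤ n * n
    4t+2n≤n² = begin
      4 * t + 2 * n            ≤⟨ +-monoˡ-≤ (2 * n) (*-monoʳ-≤ 4 t≤1+3n) ⟩
      4 * suc (3 * n) + 2 * n  ≡⟨ expand n ⟩
      14 * n + 4               ≤⟨ +-monoʳ-≤ (14 * n) (≤-trans (≤ᵇ⇒≤ 4 15 _) 15≤n) ⟩
      14 * n + n               ≡⟨ collect n ⟩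
      15 * n                   ≤⟨ *-monoˡ-≤ n 15≤n ⟩
      n * n                    ∎
      where expand : ∀ n → 4 * suc (3 * n) + 2 * n ≡ 14 * n + 4
            expand = solve-∀
            collect : ∀ n → 14 * n + n ≡ 15 * n
            collect = solve-∀
    n²+4t≤4N : n * n + 4 * t ≤ 4 * N
    n²+4t≤4N = +-cancelʳ-≤ (2 * n) (n * n + 4 * t) (4 * N) (begin
      n * n + 4 * t + 2 * n      ≡⟨ +-assoc (n * n) (4 * t) (2 * n) ⟩
      n * n + (4 * t + 2 * n)    ≤⟨ +-monoʳ-≤ (n * n) 4t+2n≤n² ⟩
      n * n + n * n              ≡⟨ cong (λ x → x + x) (2*numEdges+n≡n² n) ⟨
      (2 * N + n) + (2 * N + n)  ≡⟨ double N n ⟩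
      4 * N + 2 * n              ∎)
      where double : ∀ N n → (2 * N + n) + (2 * N + n) ≡ 4 * N + 2 * n
            double = solve-∀

ind-≤ᵇ-cases : ∀ q a → (q ≤ a × ind (q ≤ᵇ a) ≡ 1) ⊎ ind (q ≤ᵇ a) ≡ 0
ind-≤ᵇ-cases q a with q ≤ᵇ a in q≤ᵇa
... | true = inj₁ (≤ᵇ⇒≤ q a (subst T (sym q≤ᵇa) _) , refl)
... | false = inj₂ refl

module Dense (k n m a : ℕ) (dense : 524288 * suc k * n ≤ m) (sparse : a * m ^ 2 ≤ n ^ 3) (15≤n : 15 ≤ n) where

  private
    K : ℕ
    K = 524288 * suc k
    instance
      n≢0 : NonZero n
      n≢0 = >-nonZero (≤-trans (s≤s z≤n) 15≤n)

  amK≤n² : a * m * K ≤ n * n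
  amK≤n² = *-cancelʳ-≤ (a * m * K) (n * n) n (begin
      a * m * K * n    ≡⟨ *-assoc (a * m) K n ⟩
      a * m * (K * n)  ≤⟨ *-monoʳ-≤ (a * m) dense ⟩
      a * m * m        ≡⟨ square a m ⟩
      a * m ^ 2        ≤⟨ sparse ⟩
      n ^ 3            ≡⟨ cube n ⟩
      n * n * n        ∎)
    where open ≤-Reasoning
          square : ∀ a m → a * m * m ≡ a * (m * (m * 1))
          square = solve-∀
          cube : ∀ n → n * (n * (n * 1)) ≡ n * n * n
          cube = solve-∀

  Kna²m³≤n⁶ : K * n * (a * a) * (m * m * m) ≤ (n * n) * (n * n) * (n * n)
  Kna²m³≤n⁶ = begin
      K * n * (a * a) * (m * m * m)  ≡⟨ regroup K n a m ⟩
      a * a * (m * m * m) * (K * n)  ≤⟨ *-monoʳ-≤ (a * a * (m * m * m)) dense ⟩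
      a * a * (m * m * m) * m        ≡⟨ square a m ⟩
      a * m ^ 2 * (a * m ^ 2)        ≤⟨ *-mono-≤ sparse sparse ⟩
      n ^ 3 * n ^ 3                  ≡⟨ sixth n ⟩
      (n * n) * (n * n) * (n * n)    ∎
    where open ≤-Reasoning
          regroup : ∀ K n a m → K * n * (a * a) * (m * m * m) ≡ a * a * (m * m * m) * (K * n)
          regroup = solve-∀
          square : ∀ a m → a * a * (m * m * m) * m ≡ a * (m * (m * 1)) * (a * (m * (m * 1)))
          square = solve-∀
          sixth : ∀ n → n * (n * (n * 1)) * (n * (n * (n * 1))) ≡ (n * n) * (n * n) * (n * n)
          sixth = solve-∀

  a≤n : a ≤ n
  a≤n = *-cancelʳ-≤ a n n (begin
      a * n      ≤⟨ *-monoʳ-≤ a (≤-trans (m≤n*m n K) dense) ⟩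
      a * m      ≤⟨ m≤m*n (a * m) K ⟩
      a * m * K  ≤⟨ amK≤n² ⟩
      n * n      ∎)
    where open ≤-Reasoning

  module _ (q : ℕ) (q≤a : q ≤ a) where

    private
      t : ℕ
      t = suc (3 * q)
      L : ℕ
      L = numEdges n ∸ t

      n²≤4L : n * n ≤ 4 * L
      n²≤4L = n²≤4[numEdges∸t] n t 15≤n (s≤s (*-monoʳ-≤ 3 (≤-trans q≤a a≤n)))

    L≥1 : 1 ≤ L
    L≥1 = *-cancelˡ-< 4 0 L (≤-trans (*-mono-≤ (≤-trans (s≤s z≤n) 15≤n) (≤-trans (s≤s z≤n) 15≤n)) n²≤4L)

    linear : 16 * suc k * q * m ≤ L
    linear = *-cancelˡ-≤ 4 (begin
      4 * (16 * suc k * q * m)  ≡⟨ regroup (suc k) q m ⟩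
      (64 * suc k) * (q * m)    ≤⟨ *-mono-≤ (*-monoˡ-≤ (suc k) (≤ᵇ⇒≤ 64 524288 _)) (*-monoˡ-≤ m q≤a) ⟩
      K * (a * m)               ≡⟨ *-comm K (a * m) ⟩
      a * m * K                 ≤⟨ amK≤n² ⟩
      n * n                     ≤⟨ n²≤4L ⟩
      4 * L                     ∎)
      where open ≤-Reasoning
            regroup : ∀ k q m → 4 * (16 * k * q * m) ≡ (64 * k) * (q * m)
            regroup = solve-∀

    cubic : 8192 * n * (q * q) * (m * m * m) ≤ L * L * L
    cubic = *-cancelˡ-≤ 64 (begin
      64 * (8192 * n * (q * q) * (m * m * m))  ≡⟨ regroup n q m ⟩
      524288 * n * (q * q) * (m * m * m)       ≤⟨ *-monoˡ-≤ (m * m * m) (*-mono-≤ (*-monoˡ-≤ n 2¹⁹≤K) (*-mono-≤ q≤a q≤a)) ⟩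
      K * n * (a * a) * (m * m * m)            ≤⟨ Kna²m³≤n⁶ ⟩
      (n * n) * (n * n) * (n * n)              ≤⟨ *-mono-≤ (*-mono-≤ n²≤4L n²≤4L) n²≤4L ⟩
      4 * L * (4 * L) * (4 * L)                ≡⟨ cube L ⟩
      64 * (L * L * L)                         ∎)
      where open ≤-Reasoning
            regroup : ∀ n q m → 64 * (8192 * n * (q * q) * (m * m * m)) ≡ 524288 * n * (q * q) * (m * m * m)
            regroup = solve-∀
            cube : ∀ L → 4 * L * (4 * L) * (4 * L) ≡ 64 * (L * L * L)
            cube = solve-∀
            2¹⁹≤K : 524288 ≤ K
            2¹⁹≤K = m≤m*n 524288 (suc k)

  weighted-sizeTerm-≤ : ∀ q → 2 ^ suc q * (suc k * ((n C q) * sizeTerm a m n q)) ≤ numEdges n C m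
  weighted-sizeTerm-≤ q = [ included , excluded ]′ (ind-≤ᵇ-cases q a)
    where
      open ≤-Reasoning
      X : ℕ
      X = ((q * q) C suc (3 * q)) * supersets (numEdges n) (suc (3 * q)) m
      weigh : ℕ → ℕ
      weigh x = 2 ^ suc q * (suc k * ((n C q) * x))
      included : q ≤ a × ind (q ≤ᵇ a) ≡ 1 → weigh (ind (q ≤ᵇ a) * X) ≤ numEdges n C m
      included (q≤a , [q≤a]≡1) = begin
        weigh (ind (q ≤ᵇ a) * X)  ≡⟨ cong (λ i → weigh (i * X)) [q≤a]≡1 ⟩
        weigh (1 * X)             ≡⟨ cong weigh (*-identityˡ X) ⟩
        weigh X                   ≤⟨ term-bound (suc k) n m q (numEdges n) (L≥1 q q≤a) (linear q q≤a) (cubic q q≤a) ⟩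
        numEdges n C m            ∎
      excluded : ind (q ≤ᵇ a) ≡ 0 → weigh (ind (q ≤ᵇ a) * X) ≤ numEdges n C m
      excluded [q≤a]≡0 = begin
        weigh (ind (q ≤ᵇ a) * X)             ≡⟨ cong (λ i → weigh (i * X)) [q≤a]≡0 ⟩
        2 ^ suc q * (suc k * ((n C q) * 0))  ≡⟨ cong (λ x → 2 ^ suc q * (suc k * x)) (*-zeroʳ (n C q)) ⟩
        2 ^ suc q * (suc k * 0)              ≡⟨ cong (2 ^ suc q *_) (*-zeroʳ (suc k)) ⟩
        2 ^ suc q * 0                        ≡⟨ *-zeroʳ (2 ^ suc q) ⟩
        0                                    ≤⟨ z≤n ⟩
        numEdges n C m                       ∎

totalCount≡ : ∀ m n → totalCount m n ≡ numEdges n C m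
totalCount≡ m n = trans (length-boolFilter (λ G → card G ≡ᵇ m) (allVecs (numEdges n))) (#card≡ (numEdges n) m)

lemma4p3 : (a m : ℕ → ℕ)
    → (∀ K → ∃[ N₀ ] (∀ n → N₀ ≤ n → K ≤ a n))
    → (∀ K → ∃[ N₀ ] (∀ n → N₀ ≤ n → K * n ≤ m n))
    → ∃[ N₀ ] (∀ n → N₀ ≤ n → a n * m n ^ 2 ≤ n ^ 3)
    → ∀ k → ∃[ N₀ ] (∀ n → N₀ ≤ n → suc k * badCount (a n) (m n) n ≤ totalCount (m n) n)
lemma4p3 a m _ dense (N₂ , sparse) k = N₁ + N₂ + 15 , bound
  where
    N₁ : ℕ
    N₁ = proj₁ (dense (524288 * suc k))
    bound : ∀ n → N₁ + N₂ + 15 ≤ n → suc k * badCount (a n) (m n) n ≤ totalCount (m n) n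
    bound n n≥ = begin
        suc k * badCount (a n) (m n) n                 ≤⟨ *-monoʳ-≤ (suc k) (badCount-bound (a n) (m n) n) ⟩
        suc k * ∑[ q < suc n ] ((n C q) * term q)      ≡⟨ ∑<-distribˡ-* (suc n) (suc k) (λ q → (n C q) * term q) ⟨
        ∑[ q < suc n ] (suc k * ((n C q) * term q))    ≤⟨ ∑<-geometric-≤ (suc n) _ _ (Dense.weighted-sizeTerm-≤ k n (m n) (a n)
                                                             (proj₂ (dense (524288 * suc k)) n N₁≤n) (sparse n N₂≤n) 15≤n) ⟩
        numEdges n C m n                               ≡⟨ totalCount≡ (m n) n ⟨
        totalCount (m n) n                             ∎
      where
        open ≤-Reasoning
        term : ℕ → ℕ
        term = sizeTerm (a n) (m n) n
        N₁≤n : N₁ ≤ n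
        N₁≤n = m+n≤o⇒m≤o N₁ (m+n≤o⇒m≤o (N₁ + N₂) n≥)
        N₂≤n : N₂ ≤ n
        N₂≤n = m+n≤o⇒n≤o N₁ (m+n≤o⇒m≤o (N₁ + N₂) n≥)
        15≤n : 15 ≤ n
        15≤n = m+n≤o⇒n≤o (N₁ + N₂) n≥
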